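{- For terms of $\mathsf{LC}^\star$ and formulas of $\mathcal L$: (1) If $u[t/x]\Vdash B$ for every $t\Vdash A$, then $\lambda x\,u\Vdash A\to B$. (2) If $u[m/\alpha]\Vdash B[m/\alpha]$ for every term $m$ of $\mathcal L$, then $\lambda\alpha\,u\Vdash\forall\alpha B$. (3) If $u\Vdash A$ and $v\Vdash B$, then $\langle u,v\rangle\Vdash A\wedge B$. (4) If $t\Vdash A_i$ with $i\in\{0,1\}$, then $\iota_i(t)\Vdash A_0\vee A_1$. (5) If $t\Vdash A[m/\alpha]$, then $(m,t)\Vdash\exists\alpha A$. (6) For any two formulas $A,B$, $\mathcal A^{A\to B}\Vdash A\to B$.
   Context: Formulas. Terms of the first-order language $\mathcal{L}$ are individual variables, constants, and $f(m_1,\dots,m_n)$; atomic formulas are $P(m_1,\dots,m_n)$ including $0$-ary $\bot$; formulas are built with $\wedge,\vee,\to,\forall\alpha,\exists\alpha$. Proof terms of $\mathsf{LC}$ (Church-typed): $x^A:A$; $\langle u,t\rangle:A\wedge B$ from $u:A,t:B$; $u\pi_0:A$, $u\pi_1:B$ from $u:A\wedge B$; $tu:B$ from $t:A\to B,u:A$; $\lambda x^Au:A\to B$ from $u:B$; $\iota_0(u):A\vee B$ from $u:A$, $\iota_1(u):A\vee B$ from $u:B$; $u[x^A.w_1,y^B.w_2]:C$ from $u:A\vee B$, $w_1,w_2:C$; $um:A[m/\alpha]$ from $u:\forall\alpha A$; $\lambda\alpha u:\forall\alpha A$ from $u:A$ ($\alpha$ not free in types of free proof variables of $u$); $(m,u):\exists\alpha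 A$ from $u:A[m/\alpha]$; $u[(\alpha,x^A).t]:C$ from $u:\exists\alpha A$, $t:C$ (usual eigenvariable condition); $u\parallel_a v:C$ from $u:C$, $v:C$, where $a$ occurs in $u$ with type $A\to B$ and in $v$ with type $B\to A$, $\parallel_a$ binding $a$; $\mathsf{efq}_P(u):P$ from $u:\bot$, $P$ atomic. $\mathsf{LC}^\star$ adds constants $\mathcal A^{A\to B}:A\to B$ for all $A,B$. Stacks: finite sequences $\sigma=\sigma_1\cdot\ldots\cdot\sigma_n$ with components proof terms, terms of $\mathcal L$, $\pi_0,\pi_1$, $[x.u,y.v]$, $[(\alpha,x).v]$; $\epsilon$ empty; $t\sigma=((t\sigma_1)\ldots)\sigma_n$. Parallel context: $u_1\parallel_{a_1}\cdots[\,]\cdots\parallel_{a_n}u_n$. Basic reductions: $(\lambda xu)t\mapsto u[t/x]$; $(\lambda\alpha u)m\mapsto u[m/\alpha]$; $\langle u_0,u_1\rangle\pi_i\mapsto u_i$; $\iota_i(u)[x_0.t_0,x_1.t_1]\mapsto t_i[u/x_i]$; $(m,u)[(\alpha,x).v]\mapsto v[m/\alpha][u/x]$; $(u\parallel_a v)\xi\mapsto u\xi\parallel_a v\xi$ for $\xi$ a stack element that is a proof term, $\pi_i$, $[x.w_1,y.w_2]$ or $[(\alpha,x).w]$ in which $a$ is not free; $\mathcal C[a^{A\to B}u\sigma]\parallel_a v\mapsto\mathcal C[v[\lambda y^Bu/a^{B\to A}]]\parallel_a v$ and $v\parallel_a\mathcal C[a^{A\to B}u\sigma]\mapsto v\parallel_a\mathcal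 C[v[\lambda y^Bu/a^{B\to A}]]$ ($\mathcal C$ parallel context, $a$ free in $\mathcal C[au\sigma]$, $y$ dummy); $\mathcal Au\sigma\mapsto u$ when $\mathcal Au\sigma$ and $u$ have the same type. Head reduction $\succ$: writing $t=t_1\parallel_{a_1}\cdots\parallel_{a_n}t_{n+1}$, the $t_i$ are the parallel processes (elementary if not of the form $u\parallel_a v$). The head redex of $t$ is $h$ where $t=h\sigma$ and $h=r\xi$ with $\xi$ one stack element and $r$ one of $\lambda xu,\lambda\alpha u,\langle u,v\rangle,\iota_i(u),(m,u),u\parallel_a v$ (with $h$ a redex), or $h=t$ if $t=u\parallel_a v$ is a redex, or $h=t=\mathcal Au\sigma$ if $u$ and $t$ have the same type. The starting symbol of a redex $r\xi$ is its opening parenthesis; of a redex $u\parallel_a v$ it is the leftmost occurrence of $a$ heading an elementary process $a\,s\,\rho$. $t\succ t'$ iff $t'$ is obtained by contracting the head redex whose starting symbol is leftmost among the head redexes of the parallel processes of $t$. $\mathsf{HN}^\star$ is the set of terms of $\mathsf{LC}^\star$ with no infinite sequence $t=u_1\succ u_2\succ\cdots$. Realizability: $t\Vdash C$ iff $t:C$ and $t\sigma\in\mathsf{HN}^\star$ for all $\sigma\in\|C\|$, where: $\|P\|=\{\epsilon\}$ for $P$ atomic; $\|A\to B\|=\{u\cdot\sigma:u\Vdash A,\sigma\in\|B\|\}\cup\{\epsilon\}$; $\|A\wedge B\|=\{\pi_0\cdot\sigma:\sigma\in\|A\|\}\cup\{\pi_1\cdot\sigma:\sigma\in\|B\|\}\cup\{\epsilon\}$;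 $\|A\vee B\|=\{[x.u,y.v]\cdot\sigma:\forall t\,((t\Vdash A\Rightarrow u[t/x]\sigma\in\mathsf{HN}^\star)\wedge(t\Vdash B\Rightarrow v[t/y]\sigma\in\mathsf{HN}^\star))\}\cup\{\epsilon\}$; $\|\forall\alpha A\|=\{m\cdot\sigma:m\in\mathcal L,\sigma\in\|A[m/\alpha]\|\}\cup\{\epsilon\}$; $\|\exists\alpha A\|=\{[(\alpha,x).v]\cdot\sigma:\forall m\in\mathcal L\,\forall t\,(t\Vdash A[m/\alpha]\Rightarrow v[m/\alpha][t/x]\sigma\in\mathsf{HN}^\star)\}\cup\{\epsilon\}$. -}

module Defs where

-- Syntax of LC* with de Bruijn indices for BOTH first-order variables and
-- proof variables.

open import Data.Nat using (ℕ; zero; suc; _+_; _<_; _<ᵇ_; _≡ᵇ_; pred)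
open import Data.Bool using (Bool; true; false; if_then_else_)
open import Data.Fin using (Fin; zero; suc)
open import Data.List using (List; []; _∷_; map)
open import Data.Maybe using (Maybe; just; nothing)
open import Data.Product using (Σ; _×_; _,_)
open import Data.Sum using (_⊎_)
open import Relation.Nullary using (¬_)
open import Relation.Binary.PropositionalEquality using (_≡_)

data Tm : Set where
  var : ℕ → Tm
  cst : ℕ → Tm
  fun : ℕ → List Tm → Tm

mutual
  shT : ℕ → ℕ → Tm → Tm
  shT c n (var i) = if i <ᵇ c then var i else var (i + n)
  shT c n (cst k) = cst k
  shT c n (fun f ts) = fun f (shTs c n ts)

  shTs : ℕ → ℕ → List Tm → List Tm
  shTs c n [] = []
  shTs c n (t ∷ ts) = shT c n t ∷ shTs c n ts

sbVar : ℕ → Tm → ℕ → Tm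
sbVar k m i = if i <ᵇ k then var i else (if i ≡ᵇ k then m else var (pred i))

mutual
  sbT : ℕ → Tm → Tm → Tm
  sbT k m (var i) = sbVar k m i
  sbT k m (cst c) = cst c
  sbT k m (fun f ts) = fun f (sbTs k m ts)

  sbTs : ℕ → Tm → List Tm → List Tm
  sbTs k m [] = []
  sbTs k m (t ∷ ts) = sbT k m t ∷ sbTs k m ts

-- Formulas.  Atomic formulas: P(m1,...,mn) and the 0-ary ⊥.
-- ∀ᶠ A and ∃ᶠ A bind the first-order variable 0 in A.

infixr 6 _∧ᶠ_
infixr 5 _∨ᶠ_
infixr 4 _⇒_

data Fm : Set where
  atom  : ℕ → List Tm → Fm
  ⊥ᶠ    : Fm
  _∧ᶠ_  : Fm → Fm → Fm
  _∨ᶠ_  : Fm → Fm → Fm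
  _⇒_   : Fm → Fm → Fm
  ∀ᶠ    : Fm → Fm
  ∃ᶠ    : Fm → Fm

data Atomic : Fm → Set where
  atomA : ∀ {P ts} → Atomic (atom P ts)
  botA  : Atomic ⊥ᶠ

shF : ℕ → ℕ → Fm → Fm
shF c n (atom P ts) = atom P (shTs c n ts)
shF c n ⊥ᶠ = ⊥ᶠ
shF c n (A ∧ᶠ B) = shF c n A ∧ᶠ shF c n B
shF c n (A ∨ᶠ B) = shF c n A ∨ᶠ shF c n B
shF c n (A ⇒ B) = shF c n A ⇒ shF c n B
shF c n (∀ᶠ A) = ∀ᶠ (shF (suc c) n A)
shF c n (∃ᶠ A) = ∃ᶠ (shF (suc c) n A)

sbF : ℕ → Tm → Fm → Fm
sbF k m (atom P ts) = atom P (sbTs k m ts)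
sbF k m ⊥ᶠ = ⊥ᶠ
sbF k m (A ∧ᶠ B) = sbF k m A ∧ᶠ sbF k m B
sbF k m (A ∨ᶠ B) = sbF k m A ∨ᶠ sbF k m B
sbF k m (A ⇒ B) = sbF k m A ⇒ sbF k m B
sbF k m (∀ᶠ A) = ∀ᶠ (sbF (suc k) (shT 0 1 m) A)
sbF k m (∃ᶠ A) = ∃ᶠ (sbF (suc k) (shT 0 1 m) A)

-- size (invariant under substitution of first-order terms); used only as
-- recursion fuel for the realizability definition
size : Fm → ℕ
size (atom P ts) = 1
size ⊥ᶠ = 1
size (A ∧ᶠ B) = suc (size A + size B)
size (A ∨ᶠ B) = suc (size A + size B)
size (A ⇒ B) = suc (size A + size B)
size (∀ᶠ A) = suc (size A)
size (∃ᶠ A) = suc (size A)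

sel : {X : Set} → Fin 2 → X → X → X
sel zero x y = x
sel (suc zero) x y = y

-- Proof terms of LC*  (Church-typed: every proof-variable occurrence
-- carries its type; annotations on ι, (m,_) and efq make types unique)
--
--  pv i A          x^A  (proof variable with de Bruijn index i)
--  pair u v        ⟨u,v⟩
--  proj i u        u πᵢ
--  app t u         t u
--  lam A u         λx^A u           (binds proof var 0 in u)
--  inj i A₀ A₁ u   ιᵢ(u) : A₀ ∨ A₁
--  cases u w₁ w₂   u[x.w₁, y.w₂]     (binds proof var 0 in w₁, w₂)
--  tapp u m        u m
--  tlam u          λα u             (binds first-order var 0 in u)
--  wit m A u       (m,u) : ∃α A     (A under the binder α)
--  exe u v         u[(α,x).v]       (binds f.o. var 0 and proof var 0 in v)
--  par u v         u ∥ₐ v           (binds proof var 0 (= a) in u and v)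
--  efq P u         efq_P(u)
--  hyp A B         the constant 𝒜^{A→B}

data PT : Set where
  pv    : ℕ → Fm → PT
  pair  : PT → PT → PT
  proj  : Fin 2 → PT → PT
  app   : PT → PT → PT
  lam   : Fm → PT → PT
  inj   : Fin 2 → Fm → Fm → PT → PT
  cases : PT → PT → PT → PT
  tapp  : PT → Tm → PT
  tlam  : PT → PT
  wit   : Tm → Fm → PT → PT
  exe   : PT → PT → PT
  par   : PT → PT → PT
  efq   : Fm → PT → PT
  hyp   : Fm → Fm → PT

shFO : ℕ → ℕ → PT → PT
shFO c n (pv i A) = pv i (shF c n A)
shFO c n (pair u v) = pair (shFO c n u) (shFO c n v)
shFO c n (proj i u) = proj i (shFO c n u)
shFO c n (app t u) = app (shFO c n t) (shFO c n u)
shFO c n (lam A u) = lam (shF c n A) (shFO c n u)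
shFO c n (inj i A B u) = inj i (shF c n A) (shF c n B) (shFO c n u)
shFO c n (cases u w₁ w₂) = cases (shFO c n u) (shFO c n w₁) (shFO c n w₂)
shFO c n (tapp u m) = tapp (shFO c n u) (shT c n m)
shFO c n (tlam u) = tlam (shFO (suc c) n u)
shFO c n (wit m A u) = wit (shT c n m) (shF (suc c) n A) (shFO c n u)
shFO c n (exe u v) = exe (shFO c n u) (shFO (suc c) n v)
shFO c n (par u v) = par (shFO c n u) (shFO c n v)
shFO c n (efq P u) = efq (shF c n P) (shFO c n u)
shFO c n (hyp A B) = hyp (shF c n A) (shF c n B)

sbFO : ℕ → Tm → PT → PT
sbFO k m (pv i A) = pv i (sbF k m A)
sbFO k m (pair u v) = pair (sbFO k m u) (sbFO k m v)
sbFO k m (proj i u) = proj i (sbFO k m u)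
sbFO k m (app t u) = app (sbFO k m t) (sbFO k m u)
sbFO k m (lam A u) = lam (sbF k m A) (sbFO k m u)
sbFO k m (inj i A B u) = inj i (sbF k m A) (sbF k m B) (sbFO k m u)
sbFO k m (cases u w₁ w₂) = cases (sbFO k m u) (sbFO k m w₁) (sbFO k m w₂)
sbFO k m (tapp u m') = tapp (sbFO k m u) (sbT k m m')
sbFO k m (tlam u) = tlam (sbFO (suc k) (shT 0 1 m) u)
sbFO k m (wit m' A u) = wit (sbT k m m') (sbF (suc k) (shT 0 1 m) A) (sbFO k m u)
sbFO k m (exe u v) = exe (sbFO k m u) (sbFO (suc k) (shT 0 1 m) v)
sbFO k m (par u v) = par (sbFO k m u) (sbFO k m v)
sbFO k m (efq P u) = efq (sbF k m P) (sbFO k m u)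
sbFO k m (hyp A B) = hyp (sbF k m A) (sbF k m B)

shP : ℕ → ℕ → PT → PT
shP c n (pv i A) = if i <ᵇ c then pv i A else pv (i + n) A
shP c n (pair u v) = pair (shP c n u) (shP c n v)
shP c n (proj i u) = proj i (shP c n u)
shP c n (app t u) = app (shP c n t) (shP c n u)
shP c n (lam A u) = lam A (shP (suc c) n u)
shP c n (inj i A B u) = inj i A B (shP c n u)
shP c n (cases u w₁ w₂) = cases (shP c n u) (shP (suc c) n w₁) (shP (suc c) n w₂)
shP c n (tapp u m) = tapp (shP c n u) m
shP c n (tlam u) = tlam (shP c n u)
shP c n (wit m A u) = wit m A (shP c n u)
shP c n (exe u v) = exe (shP c n u) (shP (suc c) n v)
shP c n (par u v) = par (shP (suc c) n u) (shP (suc c) n v)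
shP c n (efq P u) = efq P (shP c n u)
shP c n (hyp A B) = hyp A B

sbP : ℕ → PT → PT → PT
sbP k t (pv i A) = if i <ᵇ k then pv i A else (if i ≡ᵇ k then t else pv (pred i) A)
sbP k t (pair u v) = pair (sbP k t u) (sbP k t v)
sbP k t (proj i u) = proj i (sbP k t u)
sbP k t (app u v) = app (sbP k t u) (sbP k t v)
sbP k t (lam A u) = lam A (sbP (suc k) (shP 0 1 t) u)
sbP k t (inj i A B u) = inj i A B (sbP k t u)
sbP k t (cases u w₁ w₂) = cases (sbP k t u) (sbP (suc k) (shP 0 1 t) w₁) (sbP (suc k) (shP 0 1 t) w₂)
sbP k t (tapp u m) = tapp (sbP k t u) m
sbP k t (tlam u) = tlam (sbP k (shFO 0 1 t) u)
sbP k t (wit m A u) = wit m A (sbP k t u)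
sbP k t (exe u v) = exe (sbP k t u) (sbP (suc k) (shP 0 1 (shFO 0 1 t)) v)
sbP k t (par u v) = par (sbP (suc k) (shP 0 1 t) u) (sbP (suc k) (shP 0 1 t) v)
sbP k t (efq P u) = efq P (sbP k t u)
sbP k t (hyp A B) = hyp A B

-- replacement of proof index k by t WITHOUT removing the binder
-- (used for v[λy u / a] where a stays bound by ∥ₐ)
rpP : ℕ → PT → PT → PT
rpP k t (pv i A) = if i ≡ᵇ k then t else pv i A
rpP k t (pair u v) = pair (rpP k t u) (rpP k t v)
rpP k t (proj i u) = proj i (rpP k t u)
rpP k t (app u v) = app (rpP k t u) (rpP k t v)
rpP k t (lam A u) = lam A (rpP (suc k) (shP 0 1 t) u)
rpP k t (inj i A B u) = inj i A B (rpP k t u)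
rpP k t (cases u w₁ w₂) = cases (rpP k t u) (rpP (suc k) (shP 0 1 t) w₁) (rpP (suc k) (shP 0 1 t) w₂)
rpP k t (tapp u m) = tapp (rpP k t u) m
rpP k t (tlam u) = tlam (rpP k (shFO 0 1 t) u)
rpP k t (wit m A u) = wit m A (rpP k t u)
rpP k t (exe u v) = exe (rpP k t u) (rpP (suc k) (shP 0 1 (shFO 0 1 t)) v)
rpP k t (par u v) = par (rpP (suc k) (shP 0 1 t) u) (rpP (suc k) (shP 0 1 t) v)
rpP k t (efq P u) = efq P (rpP k t u)
rpP k t (hyp A B) = hyp A B

-- Typing  d ∣ Γ ⊢ t ∶ C
-- d = number of enclosing first-order binders inside the term being typed,
-- Γ = types of the enclosing (bound) proof variables, index 0 first.
-- A free proof variable x^A is typed by its annotation; the eigenvariable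
-- conditions require that its type mentions none of the d bound
-- first-order variables, i.e. A is a d-fold weakening.

lk : List Fm → ℕ → Maybe Fm
lk [] i = nothing
lk (A ∷ Γ) zero = just A
lk (A ∷ Γ) (suc i) = lk Γ i

infix 3 _∣_⊢_∶_

data _∣_⊢_∶_ : ℕ → List Fm → PT → Fm → Set where
  ⊢bound : ∀ {d Γ i A} → lk Γ i ≡ just A → d ∣ Γ ⊢ pv i A ∶ A
  ⊢free  : ∀ {d Γ i A} → lk Γ i ≡ nothing → (A' : Fm) → A ≡ shF 0 d A' →
           d ∣ Γ ⊢ pv i A ∶ A
  ⊢pair  : ∀ {d Γ u v A B} → d ∣ Γ ⊢ u ∶ A → d ∣ Γ ⊢ v ∶ B → d ∣ Γ ⊢ pair u v ∶ A ∧ᶠ B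
  ⊢proj  : ∀ {d Γ u A B} i → d ∣ Γ ⊢ u ∶ A ∧ᶠ B → d ∣ Γ ⊢ proj i u ∶ sel i A B
  ⊢app   : ∀ {d Γ t u A B} → d ∣ Γ ⊢ t ∶ A ⇒ B → d ∣ Γ ⊢ u ∶ A → d ∣ Γ ⊢ app t u ∶ B
  ⊢lam   : ∀ {d Γ u A B} → d ∣ A ∷ Γ ⊢ u ∶ B → d ∣ Γ ⊢ lam A u ∶ A ⇒ B
  ⊢inj   : ∀ {d Γ u A₀ A₁} i → d ∣ Γ ⊢ u ∶ sel i A₀ A₁ → d ∣ Γ ⊢ inj i A₀ A₁ u ∶ A₀ ∨ᶠ A₁
  ⊢cases : ∀ {d Γ u w₁ w₂ A B C} → d ∣ Γ ⊢ u ∶ A ∨ᶠ B → d ∣ A ∷ Γ ⊢ w₁ ∶ C →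
           d ∣ B ∷ Γ ⊢ w₂ ∶ C → d ∣ Γ ⊢ cases u w₁ w₂ ∶ C
  ⊢tapp  : ∀ {d Γ u A} m → d ∣ Γ ⊢ u ∶ ∀ᶠ A → d ∣ Γ ⊢ tapp u m ∶ sbF 0 m A
  ⊢tlam  : ∀ {d Γ u A} → suc d ∣ map (shF 0 1) Γ ⊢ u ∶ A → d ∣ Γ ⊢ tlam u ∶ ∀ᶠ A
  ⊢wit   : ∀ {d Γ u A} m → d ∣ Γ ⊢ u ∶ sbF 0 m A → d ∣ Γ ⊢ wit m A u ∶ ∃ᶠ A
  ⊢exe   : ∀ {d Γ u v A C} → d ∣ Γ ⊢ u ∶ ∃ᶠ A →
           suc d ∣ A ∷ map (shF 0 1) Γ ⊢ v ∶ shF 0 1 C → d ∣ Γ ⊢ exe u v ∶ C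
  ⊢par   : ∀ {d Γ u v C} A B → d ∣ (A ⇒ B) ∷ Γ ⊢ u ∶ C → d ∣ (B ⇒ A) ∷ Γ ⊢ v ∶ C →
           d ∣ Γ ⊢ par u v ∶ C
  ⊢efq   : ∀ {d Γ u P} → Atomic P → d ∣ Γ ⊢ u ∶ ⊥ᶠ → d ∣ Γ ⊢ efq P u ∶ P
  ⊢hyp   : ∀ {d Γ A B} → d ∣ Γ ⊢ hyp A B ∶ A ⇒ B

infix 3 _∶_
_∶_ : PT → Fm → Set
t ∶ C = 0 ∣ [] ⊢ t ∶ C

data SE : Set where
  arg : PT → SE
  trm : Tm → SE
  prj : Fin 2 → SE
  cas : PT → PT → SE     -- [x.u, y.v]   (binds proof var 0 in u, v)
  exs : PT → SE          -- [(α,x).v]    (binds f.o. var 0, proof var 0 in v)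

Stack : Set
Stack = List SE

infixl 7 _∙_ _··_

_∙_ : PT → SE → PT
t ∙ arg u = app t u
t ∙ trm m = tapp t m
t ∙ prj i = proj i t
t ∙ cas u v = cases t u v
t ∙ exs v = exe t v

_··_ : PT → Stack → PT
t ·· [] = t
t ·· (ξ ∷ σ) = (t ∙ ξ) ·· σ

-- moving a stack element under a ∥-binder
shSE : SE → SE
shSE (arg u) = arg (shP 0 1 u)
shSE (trm m) = trm m
shSE (prj i) = prj i
shSE (cas u v) = cas (shP 1 1 u) (shP 1 1 v)
shSE (exs v) = exs (shP 1 1 v)

data ParPerm : SE → Set where
  ppArg : ∀ {u} → ParPerm (arg u)
  ppPrj : ∀ {i} → ParPerm (prj i)
  ppCas : ∀ {u v} → ParPerm (cas u v)
  ppExs : ∀ {v} → ParPerm (exs v)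

data Basic : PT → SE → PT → Set where
  β⇒ : ∀ {A u t} → Basic (lam A u) (arg t) (sbP 0 t u)
  β∀ : ∀ {u m} → Basic (tlam u) (trm m) (sbFO 0 m u)
  β∧ : ∀ {u₀ u₁ i} → Basic (pair u₀ u₁) (prj i) (sel i u₀ u₁)
  β∨ : ∀ {i A₀ A₁ u t₀ t₁} → Basic (inj i A₀ A₁ u) (cas t₀ t₁) (sbP 0 u (sel i t₀ t₁))
  β∃ : ∀ {m A u v} → Basic (wit m A u) (exs v) (sbP 0 u (sbFO 0 m v))
  β∥ : ∀ {u v ξ} → ParPerm ξ → Basic (par u v) ξ (par (u ∙ shSE ξ) (v ∙ shSE ξ))

data LocalRed (p : PT) : PT → Set where
  spine : ∀ {r ξ c σ} → p ≡ (r ∙ ξ) ·· σ → Basic r ξ c → LocalRed p (c ·· σ)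
  axiom : ∀ {A B u σ} (C : Fm) → p ≡ (hyp A B ∙ arg u) ·· σ →
          u ∶ C → p ∶ C → LocalRed p u

-- an elementary process a^{X→Y} u σ whose head variable a is bound by one
-- of the k ∥-binders above it
BoundHead : ℕ → PT → Set
BoundHead k p = Σ ℕ λ n → Σ Fm λ X → Σ Fm λ Y → Σ PT λ u → Σ Stack λ σ →
                (p ≡ (pv n (X ⇒ Y) ∙ arg u) ·· σ) × (n < k)

Active : ℕ → PT → Set
Active k p = (Σ PT (LocalRed p)) ⊎ BoundHead k p

data IsPar : PT → Set where
  isPar : ∀ {u v} → IsPar (par u v)

-- the replacement v[λy^Y u / a] inserted at a process at distance n from
-- the binder of a (R = v lives in the scope of that binder, a = index 0)
fill : ℕ → Fm → PT → PT → PT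
fill n Y u R = rpP n (lam Y (shP 0 1 u)) (shP 0 n R)

-- result of locating the leftmost head redex
data Res : Set where
  none : Res
  here : PT → Res               -- contracted inside the term: result
  up   : ℕ → (PT → PT) → Res     -- leftmost redex is a ∥-redex whose binder
                                --   lies j ∥-levels above; given the other
                                --   branch, yields the new subterm

-- LA k t r : t sits below k ∥-binders (of the whole term); r describes the
-- leftmost head redex among the parallel processes of t (processes are
-- scanned left to right; the starting symbol of a redex lies inside the
-- process that witnesses it)
data LA (k : ℕ) : PT → Res → Set where
  inert  : ∀ {p} → ¬ IsPar p → ¬ Active k p → LA k p none
  local  : ∀ {p p'} → LocalRed p p' → LA k p (here p')
  bound  : ∀ {p n X Y u σ} → p ≡ (pv n (X ⇒ Y) ∙ arg u) ·· σ → n < k →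
           LA k p (up n (fill n Y u))
  ∥none  : ∀ {L R} → LA (suc k) L none → LA (suc k) R none → LA k (par L R) none
  ∥Lhere : ∀ {L R L'} → LA (suc k) L (here L') → LA k (par L R) (here (par L' R))
  ∥Lbind : ∀ {L R f} → LA (suc k) L (up zero f) → LA k (par L R) (here (par (f R) R))
  ∥Lup   : ∀ {L R f j} → LA (suc k) L (up (suc j) f) →
           LA k (par L R) (up j (λ Q → par (f Q) R))
  ∥Rhere : ∀ {L R R'} → LA (suc k) L none → LA (suc k) R (here R') →
           LA k (par L R) (here (par L R'))
  ∥Rbind : ∀ {L R f} → LA (suc k) L none → LA (suc k) R (up zero f) →
           LA k (par L R) (here (par L (f L)))
  ∥Rup   : ∀ {L R f j} → LA (suc k) L none → LA (suc k) R (up (suc j) f) →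
           LA k (par L R) (up j (λ Q → par L (f Q)))

infix 4 _≻_
_≻_ : PT → PT → Set
t ≻ t' = LA 0 t (here t')

HN : PT → Set
HN t = ¬ (Σ (ℕ → PT) λ f → (f 0 ≡ t) × (∀ i → f i ≻ f (suc i)))

-- Realizability (by recursion on a fuel n ≥ size of the formula)

mutual
  Real : ℕ → PT → Fm → Set
  Real n t A = (t ∶ A) × (∀ σ → Stk n A σ → HN (t ·· σ))

  Stk : ℕ → Fm → Stack → Set
  Stk zero A σ = σ ≡ []
  Stk (suc n) (atom P ts) σ = σ ≡ []
  Stk (suc n) ⊥ᶠ σ = σ ≡ []
  Stk (suc n) (A ⇒ B) σ = (σ ≡ []) ⊎
    (Σ PT λ u → Σ Stack λ σ' → (σ ≡ arg u ∷ σ') × Real n u A × Stk n B σ')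
  Stk (suc n) (A ∧ᶠ B) σ = (σ ≡ []) ⊎
    ((Σ Stack λ σ' → (σ ≡ prj zero ∷ σ') × Stk n A σ') ⊎
     (Σ Stack λ σ' → (σ ≡ prj (suc zero) ∷ σ') × Stk n B σ'))
  Stk (suc n) (A ∨ᶠ B) σ = (σ ≡ []) ⊎
    (Σ PT λ u → Σ PT λ v → Σ Stack λ σ' → (σ ≡ cas u v ∷ σ') ×
      (∀ t → (Real n t A → HN (sbP 0 t u ·· σ')) × (Real n t B → HN (sbP 0 t v ·· σ'))))
  Stk (suc n) (∀ᶠ A) σ = (σ ≡ []) ⊎
    (Σ Tm λ m → Σ Stack λ σ' → (σ ≡ trm m ∷ σ') × Stk n (sbF 0 m A) σ')
  Stk (suc n) (∃ᶠ A) σ = (σ ≡ []) ⊎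
    (Σ PT λ v → Σ Stack λ σ' → (σ ≡ exs v ∷ σ') ×
      (∀ m t → Real n t (sbF 0 m A) → HN (sbP 0 t (sbFO 0 m v) ·· σ')))

infix 3 _⊩_
_⊩_ : PT → Fm → Set
t ⊩ A = Real (size A) t A

module Submission where

-- Every term r treated here is "non-eliminative": it is not of the form t ξ.
-- Such a term applied to a stack, r σ, has a unique spine decomposition, so
-- its head reduction is completely determined:
--   * with the empty stack, r (not a ∥) has no head redex at all, hence is HN;
--   * with a stack ξ·σ, the only possible head step is the basic reduction
--     r ξ ↦ c (giving c σ) or, for r = 𝒜, the axiom step 𝒜 u σ ↦ u.
-- Since a term whose every head reduct is a fixed HN term is itself HN, each
-- clause of the proposition reduces to the realizability hypothesis on the
-- contractum, read off the definition of ‖C‖.  The only bookkeeping left is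
-- that realizability is defined with a fuel parameter: its value does not
-- depend on the fuel as long as the fuel bounds the size of the formula.

open import Defs
open import Data.Nat using (zero; suc; _+_; _≤_)
open import Data.Nat.Properties
  using (≤-refl; ≤-reflexive; ≤-trans; ≤-pred; m≤m+n; m≤n+m; m+n≤o⇒m≤o; m+n≤o⇒n≤o)
open import Data.Fin using (Fin; zero; suc)
open import Data.Product using (_×_; _,_; proj₁; proj₂)
open import Data.Sum using (inj₁; inj₂)
open import Data.List using ([]; _∷_; _++_)
open import Data.List.Properties using (++-assoc; ++-identityʳ; ++-conicalʳ)
open import Data.Empty using (⊥-elim)
open import Relation.Nullary using (¬_)
open import Relation.Binary.PropositionalEquality
  using (_≡_; refl; sym; trans; cong; cong₂; subst)

headOf : PT → PT
headOf (app t u) = headOf t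
headOf (tapp t m) = headOf t
headOf (proj i t) = headOf t
headOf (cases t u v) = headOf t
headOf (exe t v) = headOf t
headOf t = t

spineOf : PT → Stack
spineOf (app t u) = spineOf t ++ (arg u ∷ [])
spineOf (tapp t m) = spineOf t ++ (trm m ∷ [])
spineOf (proj i t) = spineOf t ++ (prj i ∷ [])
spineOf (cases t u v) = spineOf t ++ (cas u v ∷ [])
spineOf (exe t v) = spineOf t ++ (exs v ∷ [])
spineOf t = []

headOf-∙ : ∀ t ξ → headOf (t ∙ ξ) ≡ headOf t
headOf-∙ t (arg u) = refl
headOf-∙ t (trm m) = refl
headOf-∙ t (prj i) = refl
headOf-∙ t (cas u v) = refl
headOf-∙ t (exs v) = refl

spineOf-∙ : ∀ t ξ → spineOf (t ∙ ξ) ≡ spineOf t ++ (ξ ∷ [])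
spineOf-∙ t (arg u) = refl
spineOf-∙ t (trm m) = refl
spineOf-∙ t (prj i) = refl
spineOf-∙ t (cas u v) = refl
spineOf-∙ t (exs v) = refl

headOf-·· : ∀ t σ → headOf (t ·· σ) ≡ headOf t
headOf-·· t [] = refl
headOf-·· t (ξ ∷ σ) = trans (headOf-·· (t ∙ ξ) σ) (headOf-∙ t ξ)

spineOf-·· : ∀ t σ → spineOf (t ·· σ) ≡ spineOf t ++ σ
spineOf-·· t [] = sym (++-identityʳ (spineOf t))
spineOf-·· t (ξ ∷ σ) = trans (spineOf-·· (t ∙ ξ) σ)
  (trans (cong (_++ σ) (spineOf-∙ t ξ)) (++-assoc (spineOf t) (ξ ∷ []) σ))

data NonElim : PT → Set where
  nePv   : ∀ {i A} → NonElim (pv i A)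
  nePair : ∀ {u v} → NonElim (pair u v)
  neLam  : ∀ {A u} → NonElim (lam A u)
  neInj  : ∀ {i A B u} → NonElim (inj i A B u)
  neTlam : ∀ {u} → NonElim (tlam u)
  neWit  : ∀ {m A u} → NonElim (wit m A u)
  nePar  : ∀ {u v} → NonElim (par u v)
  neEfq  : ∀ {P u} → NonElim (efq P u)
  neHyp  : ∀ {A B} → NonElim (hyp A B)

nonElim-headOf : ∀ {r} → NonElim r → headOf r ≡ r
nonElim-headOf nePv = refl
nonElim-headOf nePair = refl
nonElim-headOf neLam = refl
nonElim-headOf neInj = refl
nonElim-headOf neTlam = refl
nonElim-headOf neWit = refl
nonElim-headOf nePar = refl
nonElim-headOf neEfq = refl
nonElim-headOf neHyp = refl

nonElim-spineOf : ∀ {r} → NonElim r → spineOf r ≡ []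
nonElim-spineOf nePv = refl
nonElim-spineOf nePair = refl
nonElim-spineOf neLam = refl
nonElim-spineOf neInj = refl
nonElim-spineOf neTlam = refl
nonElim-spineOf neWit = refl
nonElim-spineOf nePar = refl
nonElim-spineOf neEfq = refl
nonElim-spineOf neHyp = refl

··-injective : ∀ {r r' σ σ'} → NonElim r → NonElim r' → r ·· σ ≡ r' ·· σ' →
               (r ≡ r') × (σ ≡ σ')
··-injective {r} {r'} {σ} {σ'} ne ne' e =
  trans (sym (nonElim-headOf ne))
    (trans (sym (headOf-·· r σ)) (trans (cong headOf e) (trans (headOf-·· r' σ') (nonElim-headOf ne')))) ,
  trans (cong (_++ σ) (sym (nonElim-spineOf ne)))
    (trans (sym (spineOf-·· r σ)) (trans (cong spineOf e) (trans (spineOf-·· r' σ') (cong (_++ σ') (nonElim-spineOf ne')))))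

nonEmpty-spineOf : ∀ r ξ σ → ¬ (spineOf (r ·· (ξ ∷ σ)) ≡ [])
nonEmpty-spineOf r ξ σ e with ++-conicalʳ (spineOf r) (ξ ∷ σ) (trans (sym (spineOf-·· r (ξ ∷ σ))) e)
... | ()

par≢·· : ∀ {L R} r ξ σ → ¬ (par L R ≡ r ·· (ξ ∷ σ))
par≢·· r ξ σ e = nonEmpty-spineOf r ξ σ (sym (cong spineOf e))

basic-nonElim : ∀ {r ξ c} → Basic r ξ c → NonElim r
basic-nonElim β⇒ = neLam
basic-nonElim β∀ = neTlam
basic-nonElim β∧ = nePair
basic-nonElim β∨ = neInj
basic-nonElim β∃ = neWit
basic-nonElim (β∥ _) = nePar

basic-deterministic : ∀ {r ξ c c'} → Basic r ξ c → Basic r ξ c' → c ≡ c'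
basic-deterministic β⇒ β⇒ = refl
basic-deterministic β∀ β∀ = refl
basic-deterministic β∧ β∧ = refl
basic-deterministic β∨ β∨ = refl
basic-deterministic β∃ β∃ = refl
basic-deterministic (β∥ _) (β∥ _) = refl

data HeadStep : PT → SE → Stack → PT → Set where
  basicStep : ∀ {r ξ c σ} → Basic r ξ c → HeadStep r ξ σ (c ·· σ)
  axiomStep : ∀ {A B u σ} → HeadStep (hyp A B) (arg u) σ u

headStep : ∀ {p q r ξ σ} → NonElim r → p ≡ r ·· (ξ ∷ σ) → p ≻ q → HeadStep r ξ σ q
headStep {r = r} {ξ} {σ} ne eq (local (spine {r'} {ξ'} {σ = σ'} e b))
  with ··-injective {r'} {r} {ξ' ∷ σ'} {ξ ∷ σ} (basic-nonElim b) ne (trans (sym e) eq)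
... | refl , refl = basicStep b
headStep {r = r} {ξ} {σ} ne eq (local (axiom {A} {B} {u} {σ'} C e _ _))
  with ··-injective {hyp A B} {r} {arg u ∷ σ'} {ξ ∷ σ} neHyp ne (trans (sym e) eq)
... | refl , refl = axiomStep
headStep {r = r} {ξ} {σ} ne eq (∥Lhere _) = ⊥-elim (par≢·· r ξ σ eq)
headStep {r = r} {ξ} {σ} ne eq (∥Lbind _) = ⊥-elim (par≢·· r ξ σ eq)
headStep {r = r} {ξ} {σ} ne eq (∥Rhere _ _) = ⊥-elim (par≢·· r ξ σ eq)
headStep {r = r} {ξ} {σ} ne eq (∥Rbind _ _) = ⊥-elim (par≢·· r ξ σ eq)

nonElim-no-step : ∀ {p q} → NonElim p → ¬ IsPar p → ¬ (p ≻ q)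
nonElim-no-step ne np (local (spine {r} {ξ} {σ = σ} e _)) =
  nonEmpty-spineOf r ξ σ (trans (sym (cong spineOf e)) (nonElim-spineOf ne))
nonElim-no-step ne np (local (axiom {A} {B} {u} {σ} _ e _ _)) =
  nonEmpty-spineOf (hyp A B) (arg u) σ (trans (sym (cong spineOf e)) (nonElim-spineOf ne))
nonElim-no-step ne np (∥Lhere _) = np isPar
nonElim-no-step ne np (∥Lbind _) = np isPar
nonElim-no-step ne np (∥Rhere _ _) = np isPar
nonElim-no-step ne np (∥Rbind _ _) = np isPar

HN-expand : ∀ {p q} → (∀ {q'} → p ≻ q' → q' ≡ q) → HN q → HN p
HN-expand unique hq (f , f0 , steps) =
  hq ((λ i → f (suc i)) , unique (subst (_≻ f 1) f0 (steps 0)) , λ i → steps (suc i))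

HN-normal : ∀ {p} → (∀ {q} → ¬ (p ≻ q)) → HN p
HN-normal stuck (f , f0 , steps) = stuck (subst (_≻ f 1) f0 (steps 0))

HN-basic : ∀ {r ξ c} σ → Basic r ξ c → HN (c ·· σ) → HN (r ·· (ξ ∷ σ))
HN-basic σ b = HN-expand (λ st → onlyStep b (headStep {σ = σ} (basic-nonElim b) refl st))
  where
  onlyStep : ∀ {r ξ c σ q} → Basic r ξ c → HeadStep r ξ σ q → q ≡ c ·· σ
  onlyStep {σ = σ} b (basicStep b') = cong (_·· σ) (basic-deterministic b' b)
  onlyStep () axiomStep

HN-axiom : ∀ {A B u} σ → HN u → HN (hyp A B ·· (arg u ∷ σ))
HN-axiom σ = HN-expand (λ st → onlyStep (headStep {σ = σ} neHyp refl st))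
  where
  onlyStep : ∀ {A B u σ q} → HeadStep (hyp A B) (arg u) σ q → q ≡ u
  onlyStep (basicStep ())
  onlyStep axiomStep = refl

-- A typed non-eliminative, non-∥ term realizes C once r σ is HN for the
-- non-empty stacks σ of ‖C‖; the empty stack is handled by normality.
realize-nonElim : ∀ {r C} → NonElim r → ¬ IsPar r → r ∶ C →
                  (∀ ξ σ → Stk (size C) C (ξ ∷ σ) → HN (r ·· (ξ ∷ σ))) → r ⊩ C
realize-nonElim ne np ty onStack = ty , λ where
  [] _ → HN-normal (nonElim-no-step ne np)
  (ξ ∷ σ) s → onStack ξ σ s

size-sbF : ∀ k m A → size (sbF k m A) ≡ size A
size-sbF k m (atom P ts) = refl
size-sbF k m ⊥ᶠ = refl
size-sbF k m (A ∧ᶠ B) = cong₂ (λ a b → suc (a + b)) (size-sbF k m A) (size-sbF k m B)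
size-sbF k m (A ∨ᶠ B) = cong₂ (λ a b → suc (a + b)) (size-sbF k m A) (size-sbF k m B)
size-sbF k m (A ⇒ B) = cong₂ (λ a b → suc (a + b)) (size-sbF k m A) (size-sbF k m B)
size-sbF k m (∀ᶠ A) = cong suc (size-sbF (suc k) (shT 0 1 m) A)
size-sbF k m (∃ᶠ A) = cong suc (size-sbF (suc k) (shT 0 1 m) A)

size-sbF-≤ : ∀ {n} k m A → size A ≤ n → size (sbF k m A) ≤ n
size-sbF-≤ k m A = ≤-trans (≤-reflexive (size-sbF k m A))

size≰0 : ∀ A → ¬ (size A ≤ 0)
size≰0 (atom P ts) ()
size≰0 ⊥ᶠ ()
size≰0 (A ∧ᶠ B) ()
size≰0 (A ∨ᶠ B) ()
size≰0 (A ⇒ B) ()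
size≰0 (∀ᶠ A) ()
size≰0 (∃ᶠ A) ()

-- Fuel independence: ‖A‖ and realizability of A agree at all fuels ≥ size A.
-- (The two are proved together since ‖A ⇒ B‖ mentions realizers of A.)
mutual
  Stk-fuel : ∀ n m A σ → size A ≤ n → size A ≤ m → Stk n A σ → Stk m A σ
  Stk-fuel zero m A σ p q s = ⊥-elim (size≰0 A p)
  Stk-fuel (suc n) zero A σ p q s = ⊥-elim (size≰0 A q)
  Stk-fuel (suc n) (suc m) (atom P ts) σ p q s = s
  Stk-fuel (suc n) (suc m) ⊥ᶠ σ p q s = s
  Stk-fuel (suc n) (suc m) (A ∧ᶠ B) σ p q (inj₁ e) = inj₁ e
  Stk-fuel (suc n) (suc m) (A ∧ᶠ B) σ p q (inj₂ (inj₁ (σ' , e , s))) =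
    inj₂ (inj₁ (σ' , e , Stk-fuel n m A σ' (m+n≤o⇒m≤o _ (≤-pred p)) (m+n≤o⇒m≤o _ (≤-pred q)) s))
  Stk-fuel (suc n) (suc m) (A ∧ᶠ B) σ p q (inj₂ (inj₂ (σ' , e , s))) =
    inj₂ (inj₂ (σ' , e , Stk-fuel n m B σ' (m+n≤o⇒n≤o _ (≤-pred p)) (m+n≤o⇒n≤o _ (≤-pred q)) s))
  Stk-fuel (suc n) (suc m) (A ∨ᶠ B) σ p q (inj₁ e) = inj₁ e
  Stk-fuel (suc n) (suc m) (A ∨ᶠ B) σ p q (inj₂ (u , v , σ' , e , branches)) =
    inj₂ (u , v , σ' , e , λ t →
      (λ r → proj₁ (branches t) (Real-fuel m n A t (m+n≤o⇒m≤o _ (≤-pred q)) (m+n≤o⇒m≤o _ (≤-pred p)) r)) ,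
      (λ r → proj₂ (branches t) (Real-fuel m n B t (m+n≤o⇒n≤o _ (≤-pred q)) (m+n≤o⇒n≤o _ (≤-pred p)) r)))
  Stk-fuel (suc n) (suc m) (A ⇒ B) σ p q (inj₁ e) = inj₁ e
  Stk-fuel (suc n) (suc m) (A ⇒ B) σ p q (inj₂ (u , σ' , e , r , s)) =
    inj₂ (u , σ' , e ,
          Real-fuel n m A u (m+n≤o⇒m≤o _ (≤-pred p)) (m+n≤o⇒m≤o _ (≤-pred q)) r ,
          Stk-fuel n m B σ' (m+n≤o⇒n≤o _ (≤-pred p)) (m+n≤o⇒n≤o _ (≤-pred q)) s)
  Stk-fuel (suc n) (suc m) (∀ᶠ A) σ p q (inj₁ e) = inj₁ e
  Stk-fuel (suc n) (suc m) (∀ᶠ A) σ p q (inj₂ (t , σ' , e , s)) =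
    inj₂ (t , σ' , e , Stk-fuel n m (sbF 0 t A) σ'
                         (size-sbF-≤ 0 t A (≤-pred p)) (size-sbF-≤ 0 t A (≤-pred q)) s)
  Stk-fuel (suc n) (suc m) (∃ᶠ A) σ p q (inj₁ e) = inj₁ e
  Stk-fuel (suc n) (suc m) (∃ᶠ A) σ p q (inj₂ (v , σ' , e , body)) =
    inj₂ (v , σ' , e , λ t u r →
      body t u (Real-fuel m n (sbF 0 t A) u (size-sbF-≤ 0 t A (≤-pred q)) (size-sbF-≤ 0 t A (≤-pred p)) r))

  Real-fuel : ∀ n m A t → size A ≤ n → size A ≤ m → Real n t A → Real m t A
  Real-fuel n m A t p q (ty , hn) = ty , λ σ s → hn σ (Stk-fuel m n A σ q p s)

⊩-from : ∀ {n t} A → size A ≤ n → Real n t A → t ⊩ A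
⊩-from {n} {t} A p = Real-fuel n (size A) A t p ≤-refl

⊩-to : ∀ {n t} A → size A ≤ n → t ⊩ A → Real n t A
⊩-to {n} {t} A p = Real-fuel (size A) n A t ≤-refl p

‖‖-from : ∀ {n σ} A → size A ≤ n → Stk n A σ → Stk (size A) A σ
‖‖-from {n} {σ} A p = Stk-fuel n (size A) A σ p ≤-refl

-- A realizer of any formula is HN, using the empty stack ε ∈ ‖A‖.
nil∈‖‖ : ∀ n A → Stk n A []
nil∈‖‖ zero A = refl
nil∈‖‖ (suc n) (atom P ts) = refl
nil∈‖‖ (suc n) ⊥ᶠ = refl
nil∈‖‖ (suc n) (A ∧ᶠ B) = inj₁ refl
nil∈‖‖ (suc n) (A ∨ᶠ B) = inj₁ refl
nil∈‖‖ (suc n) (A ⇒ B) = inj₁ refl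
nil∈‖‖ (suc n) (∀ᶠ A) = inj₁ refl
nil∈‖‖ (suc n) (∃ᶠ A) = inj₁ refl

realizer-HN : ∀ {t} A → t ⊩ A → HN t
realizer-HN A (_ , hn) = hn [] (nil∈‖‖ (size A) A)

lam-realizes : ∀ (A B : Fm) (u : PT) → lam A u ∶ (A ⇒ B) →
               (∀ t → t ⊩ A → sbP 0 t u ⊩ B) → lam A u ⊩ (A ⇒ B)
lam-realizes A B u ty body = realize-nonElim neLam (λ ()) ty onStack
  where
  onStack : ∀ ξ σ → Stk (size (A ⇒ B)) (A ⇒ B) (ξ ∷ σ) → HN (lam A u ·· (ξ ∷ σ))
  onStack _ _ (inj₁ ())
  onStack _ _ (inj₂ (t , σ , refl , t⊩A , σ∈B)) =
    HN-basic σ β⇒ (proj₂ (body t (⊩-from A (m≤m+n _ _) t⊩A)) σ (‖‖-from B (m≤n+m _ _) σ∈B))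

tlam-realizes : ∀ (B : Fm) (u : PT) → tlam u ∶ ∀ᶠ B →
                (∀ (m : Tm) → sbFO 0 m u ⊩ sbF 0 m B) → tlam u ⊩ ∀ᶠ B
tlam-realizes B u ty body = realize-nonElim neTlam (λ ()) ty onStack
  where
  onStack : ∀ ξ σ → Stk (size (∀ᶠ B)) (∀ᶠ B) (ξ ∷ σ) → HN (tlam u ·· (ξ ∷ σ))
  onStack _ _ (inj₁ ())
  onStack _ _ (inj₂ (m , σ , refl , σ∈Bm)) =
    HN-basic σ β∀ (proj₂ (body m) σ (‖‖-from (sbF 0 m B) (size-sbF-≤ 0 m B ≤-refl) σ∈Bm))

pair-realizes : ∀ (A B : Fm) (u v : PT) → u ⊩ A → v ⊩ B → pair u v ⊩ (A ∧ᶠ B)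
pair-realizes A B u v u⊩A v⊩B = realize-nonElim nePair (λ ()) (⊢pair (proj₁ u⊩A) (proj₁ v⊩B)) onStack
  where
  onStack : ∀ ξ σ → Stk (size (A ∧ᶠ B)) (A ∧ᶠ B) (ξ ∷ σ) → HN (pair u v ·· (ξ ∷ σ))
  onStack _ _ (inj₁ ())
  onStack _ _ (inj₂ (inj₁ (σ , refl , σ∈A))) =
    HN-basic σ (β∧ {i = zero}) (proj₂ u⊩A σ (‖‖-from A (m≤m+n _ _) σ∈A))
  onStack _ _ (inj₂ (inj₂ (σ , refl , σ∈B))) =
    HN-basic σ (β∧ {i = suc zero}) (proj₂ v⊩B σ (‖‖-from B (m≤n+m _ _) σ∈B))

inj-realizes : ∀ (i : Fin 2) (A₀ A₁ : Fm) (t : PT) → t ⊩ sel i A₀ A₁ → inj i A₀ A₁ t ⊩ (A₀ ∨ᶠ A₁)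
inj-realizes i A₀ A₁ t t⊩Ai = realize-nonElim neInj (λ ()) (⊢inj i (proj₁ t⊩Ai)) onStack
  where
  selected : ∀ {u v σ} →
             (Real (size A₀ + size A₁) t A₀ → HN (sbP 0 t u ·· σ)) ×
             (Real (size A₀ + size A₁) t A₁ → HN (sbP 0 t v ·· σ)) →
             ∀ i → t ⊩ sel i A₀ A₁ → HN (sbP 0 t (sel i u v) ·· σ)
  selected branches zero r = proj₁ branches (⊩-to A₀ (m≤m+n _ _) r)
  selected branches (suc zero) r = proj₂ branches (⊩-to A₁ (m≤n+m _ _) r)

  onStack : ∀ ξ σ → Stk (size (A₀ ∨ᶠ A₁)) (A₀ ∨ᶠ A₁) (ξ ∷ σ) → HN (inj i A₀ A₁ t ·· (ξ ∷ σ))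
  onStack _ _ (inj₁ ())
  onStack _ _ (inj₂ (u , v , σ , refl , branches)) =
    HN-basic σ β∨ (selected {u} {v} {σ} (branches t) i t⊩Ai)

wit-realizes : ∀ (m : Tm) (A : Fm) (t : PT) → t ⊩ sbF 0 m A → wit m A t ⊩ ∃ᶠ A
wit-realizes m A t t⊩Am = realize-nonElim neWit (λ ()) (⊢wit m (proj₁ t⊩Am)) onStack
  where
  onStack : ∀ ξ σ → Stk (size (∃ᶠ A)) (∃ᶠ A) (ξ ∷ σ) → HN (wit m A t ·· (ξ ∷ σ))
  onStack _ _ (inj₁ ())
  onStack _ _ (inj₂ (v , σ , refl , body)) =
    HN-basic σ β∃ (body m t (⊩-to (sbF 0 m A) (size-sbF-≤ 0 m A ≤-refl) t⊩Am))

-- (6) 𝒜 ⊩ A → B: on a stack u·σ its only step leads to the HN term u.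
hyp-realizes : ∀ (A B : Fm) → hyp A B ⊩ (A ⇒ B)
hyp-realizes A B = realize-nonElim neHyp (λ ()) ⊢hyp onStack
  where
  onStack : ∀ ξ σ → Stk (size (A ⇒ B)) (A ⇒ B) (ξ ∷ σ) → HN (hyp A B ·· (ξ ∷ σ))
  onStack _ _ (inj₁ ())
  onStack _ _ (inj₂ (u , σ , refl , u⊩A , _)) =
    HN-axiom σ (realizer-HN A (⊩-from A (m≤m+n _ _) u⊩A))

proposition3p5 :
    (∀ (A B : Fm) (u : PT) → lam A u ∶ (A ⇒ B) →
       (∀ t → t ⊩ A → sbP 0 t u ⊩ B) → lam A u ⊩ (A ⇒ B))
    × (∀ (B : Fm) (u : PT) → tlam u ∶ ∀ᶠ B →
       (∀ (m : Tm) → sbFO 0 m u ⊩ sbF 0 m B) → tlam u ⊩ ∀ᶠ B)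
    × (∀ (A B : Fm) (u v : PT) → u ⊩ A → v ⊩ B → pair u v ⊩ (A ∧ᶠ B))
    × (∀ (i : Fin 2) (A₀ A₁ : Fm) (t : PT) → t ⊩ sel i A₀ A₁ → inj i A₀ A₁ t ⊩ (A₀ ∨ᶠ A₁))
    × (∀ (m : Tm) (A : Fm) (t : PT) → t ⊩ sbF 0 m A → wit m A t ⊩ ∃ᶠ A)
    × (∀ (A B : Fm) → hyp A B ⊩ (A ⇒ B))
proposition3p5 =
  lam-realizes , tlam-realizes , pair-realizes , inj-realizes , wit-realizes , hyp-realizes
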